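{- Let $G$ and $F$ be $r$-graphs and suppose $G$ is $(r-1)$-shadow-homomorphic to $F$, witnessed as follows: for each $S\in\partial_{r-1}G$ there are $f(S)\in\partial_{r-1}F$ and a bijection $g_S:S\to f(S)$, and for each edge $E\in E(G)$ there are an edge $f(E)\in E(F)$ and a bijection $g_E:E\to f(E)$ such that $g_S=g_E|_S$ for every $(r-1)$-subset $S\subseteq E$. Let $E_1,E_2,E_3$ be edges of $G$ with $|E_1\cap E_2|=|E_1\cap E_3|=|E_2\cap E_3|=r-1$ and $|E_1\cap E_2\cap E_3|=r-2$. Then $f(E_1)\ne f(E_2)$.
   Context: An $r$-graph is an $r$-uniform hypergraph. For an $r$-graph $H$, $\partial_k H=\bigcup_{e\in E(H)}\binom{e}{k}$ is its $k$-shadow. An $r$-graph $A$ is $k$-shadow-homomorphic to an $r$-graph $B$ if one can choose for each $S\in\partial_k A$ a set $f(S)\in\partial_k B$ and a bijection $g_S:S\to f(S)$ such that for every edge $e\in E(A)$ there exist an edge $e'\in E(B)$ and a bijection $g:e\to e'$ with $g|_S=g_S$ for every $S\in\binom{e}{k}$. -}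

module Defs where

open import Level using (Level; suc; _⊔_)
open import Data.Nat using (ℕ; _+_)
open import Data.Fin using (Fin)
open import Data.Fin.Subset using (Subset; _∈_; _⊆_; ∣_∣)
open import Data.Product using (Σ; ∃; _×_; proj₁; _,_)
open import Function.Bundles using (_⤖_; Bijection)
open import Relation.Binary.PropositionalEquality using (_≡_)

record RGraph (r n : ℕ) : Set₁ where
  field
    IsEdge  : Subset n → Set
    uniform : ∀ e → IsEdge e → ∣ e ∣ ≡ r
open RGraph public

Elem : ∀ {n} → Subset n → Set
Elem {n} S = Σ (Fin n) (λ x → x ∈ S)

incl : ∀ {n} {S T : Subset n} → S ⊆ T → Elem S → Elem T
incl S⊆T (x , x∈S) = x , S⊆T x∈S

-- S ∈ ∂_{r-1} H : S is an (r-1)-subset of some edge of H.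
-- (|S| + 1 ≡ r encodes |S| = r - 1 without truncated subtraction.)
InShadow : ∀ {r n} → RGraph r n → Subset n → Set
InShadow {r} H S = (∣ S ∣ + 1 ≡ r) × ∃ (λ e → IsEdge H e × S ⊆ e)

record ShadowHomWitness {r n m : ℕ} (G : RGraph r n) (F : RGraph r m) : Set₁ where
  field
    fS       : (S : Subset n) → InShadow G S → Subset m
    fS-shad  : ∀ S (p : InShadow G S) → InShadow F (fS S p)
    gS       : ∀ S (p : InShadow G S) → Elem S ⤖ Elem (fS S p)
    fE       : (E : Subset n) → IsEdge G E → Subset m
    fE-edge  : ∀ E (p : IsEdge G E) → IsEdge F (fE E p)
    gE       : ∀ E (p : IsEdge G E) → Elem E ⤖ Elem (fE E p)
    compat   : ∀ E (p : IsEdge G E) S (q : InShadow G S) (S⊆E : S ⊆ E) (x : Elem S) →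
               proj₁ (Bijection.to (gS S q) x) ≡ proj₁ (Bijection.to (gE E p) (incl S⊆E x))
open ShadowHomWitness public

{-# OPTIONS --safe #-}
module Submission where

-- Suppose f(E₁) = f(E₂). Counting gives a vertex a ∈ E₁ ∩ E₃ outside E₂, and inclusion–exclusion
-- for E₁ ∩ E₂ and E₂ ∩ E₃ inside E₂ gives E₂ ⊆ E₁ ∪ E₃. Two edges meeting in r - 1 vertices meet in
-- a set of the (r-1)-shadow, so their maps g_E agree there. As g_{E₁}(a) ∈ f(E₂), it is g_{E₂}(y)
-- for some y ∈ E₂. If y ∈ E₁ then g_{E₁}(y) = g_{E₂}(y) = g_{E₁}(a); if y ∈ E₃ then
-- g_{E₃}(y) = g_{E₂}(y) = g_{E₁}(a) = g_{E₃}(a). Either way injectivity gives a = y ∈ E₂.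

open import Defs
open import Data.Nat using (ℕ; suc; _+_; _≤_; _<_)
open import Data.Nat.Properties
  using (+-suc; +-comm; +-monoʳ-≤; +-cancelʳ-≤; +-cancelʳ-<; ≤-reflexive; <⇒≱; ≤-<-trans; module ≤-Reasoning)
open import Data.Fin using (Fin)
open import Data.Fin.Properties using (any?)
open import Data.Fin.Subset using (Subset; _∈_; _∉_; _⊆_; _∩_; _∪_; ∣_∣; inside; outside)
open import Data.Fin.Subset.Properties
  using (_∈?_; p⊆q⇒∣p∣≤∣q∣; p⊂q⇒∣p∣<∣q∣; p∩q⊆p; p∩q⊆q; x∈p∩q⁺; x∈p∪q⁻; x∈p∪q⁺)
open import Data.Vec using ([]; _∷_)
open import Data.Vec.Properties.WithK using ([]=-irrelevant)
open import Data.Product using (∃; Σ-syntax; _×_; _,_; proj₁; proj₂)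
import Data.Sum as Sum
open import Data.Sum using (inj₁; inj₂; [_,_]′)
open import Relation.Nullary using (yes; no; ¬?; contradiction)
open import Relation.Nullary.Decidable using (_×-dec_; decidable-stable)
open import Relation.Binary.PropositionalEquality
  using (_≡_; _≢_; refl; sym; trans; cong; subst; module ≡-Reasoning)
open import Function.Bundles using (Bijection)

private
  variable
    n : ℕ
    p q : Subset n

m+n≡o+p∧n<p⇒o<m : ∀ {m n o p} → m + n ≡ o + p → n < p → o < m
m+n≡o+p∧n<p⇒o<m {m} {n} {o} {p} eq n<p = +-cancelʳ-≤ n (suc o) m (begin
  suc o + n  ≡⟨ +-suc o n ⟨
  o + suc n  ≤⟨ +-monoʳ-≤ o n<p ⟩
  o + p      ≡⟨ eq ⟨
  m + n      ∎)
  where open ≤-Reasoning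

m+2≡r∧n+1≡r⇒m<n : ∀ {m n r} → m + 2 ≡ r → n + 1 ≡ r → m < n
m+2≡r∧n+1≡r⇒m<n {m} hm hn = +-cancelʳ-< 1 m _ (≤-reflexive (trans (sym (+-suc m 1)) (trans hm (sym hn))))

∣p∪q∣+∣p∩q∣≡∣p∣+∣q∣ : ∀ (p q : Subset n) → ∣ p ∪ q ∣ + ∣ p ∩ q ∣ ≡ ∣ p ∣ + ∣ q ∣
∣p∪q∣+∣p∩q∣≡∣p∣+∣q∣ []            []            = refl
∣p∪q∣+∣p∩q∣≡∣p∣+∣q∣ (outside ∷ p) (outside ∷ q) = ∣p∪q∣+∣p∩q∣≡∣p∣+∣q∣ p q
∣p∪q∣+∣p∩q∣≡∣p∣+∣q∣ (inside  ∷ p) (outside ∷ q) = cong suc (∣p∪q∣+∣p∩q∣≡∣p∣+∣q∣ p q)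
∣p∪q∣+∣p∩q∣≡∣p∣+∣q∣ (outside ∷ p) (inside  ∷ q) =
  trans (cong suc (∣p∪q∣+∣p∩q∣≡∣p∣+∣q∣ p q)) (sym (+-suc ∣ p ∣ ∣ q ∣))
∣p∪q∣+∣p∩q∣≡∣p∣+∣q∣ (inside  ∷ p) (inside  ∷ q) = cong suc (begin
  ∣ p ∪ q ∣ + suc ∣ p ∩ q ∣  ≡⟨ +-suc ∣ p ∪ q ∣ ∣ p ∩ q ∣ ⟩
  suc (∣ p ∪ q ∣ + ∣ p ∩ q ∣) ≡⟨ cong suc (∣p∪q∣+∣p∩q∣≡∣p∣+∣q∣ p q) ⟩
  suc (∣ p ∣ + ∣ q ∣)         ≡⟨ +-suc ∣ p ∣ ∣ q ∣ ⟨
  ∣ p ∣ + suc ∣ q ∣          ∎)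
  where open ≡-Reasoning

∣q∣<∣p∣⇒∃[p∖q] : ∣ q ∣ < ∣ p ∣ → ∃ λ x → x ∈ p × x ∉ q
∣q∣<∣p∣⇒∃[p∖q] {q = q} {p = p} ∣q∣<∣p∣ with any? (λ x → x ∈? p ×-dec ¬? (x ∈? q))
... | yes found = found
... | no none   = contradiction (p⊆q⇒∣p∣≤∣q∣ p⊆q) (<⇒≱ ∣q∣<∣p∣)
  where
  p⊆q : p ⊆ q
  p⊆q {x} x∈p = decidable-stable (x ∈? q) (λ x∉q → none (x , x∈p , x∉q))

p⊆q⇒∣q∣≤∣p∣⇒q⊆p : p ⊆ q → ∣ q ∣ ≤ ∣ p ∣ → q ⊆ p
p⊆q⇒∣q∣≤∣p∣⇒q⊆p {p = p} p⊆q ∣q∣≤∣p∣ {x} x∈q =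
  decidable-stable (x ∈? p) (λ x∉p → <⇒≱ (p⊂q⇒∣p∣<∣q∣ (p⊆q , x , x∈q , x∉p)) ∣q∣≤∣p∣)

Elem-≡ : ∀ {S : Subset n} {u v : Elem S} → proj₁ u ≡ proj₁ v → u ≡ v
Elem-≡ {u = x , x∈S} {v = .x , x∈S′} refl = cong (x ,_) ([]=-irrelevant x∈S x∈S′)

module _ {r} {E₁ E₂ E₃ : Subset n}
         (h₁₃ : ∣ E₁ ∩ E₃ ∣ + 1 ≡ r) (h₁₂₃ : ∣ E₁ ∩ E₂ ∩ E₃ ∣ + 2 ≡ r) where

  ∃[E₁∩E₃∖E₂] : ∃ λ a → a ∈ E₁ × a ∈ E₃ × a ∉ E₂
  ∃[E₁∩E₃∖E₂] with ∣q∣<∣p∣⇒∃[p∖q] (m+2≡r∧n+1≡r⇒m<n h₁₂₃ h₁₃)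
  ... | a , a∈E₁∩E₃ , a∉E₁∩E₂∩E₃ =
    a , a∈E₁ , a∈E₃ , λ a∈E₂ → a∉E₁∩E₂∩E₃ (x∈p∩q⁺ (a∈E₁ , x∈p∩q⁺ (a∈E₂ , a∈E₃)))
    where
    a∈E₁ : a ∈ E₁
    a∈E₁ = p∩q⊆p E₁ E₃ a∈E₁∩E₃
    a∈E₃ : a ∈ E₃
    a∈E₃ = p∩q⊆q E₁ E₃ a∈E₁∩E₃

module _ {r} {E₁ E₂ E₃ : Subset n} (∣E₂∣≡r : ∣ E₂ ∣ ≡ r)
         (h₁₂ : ∣ E₁ ∩ E₂ ∣ + 1 ≡ r) (h₂₃ : ∣ E₂ ∩ E₃ ∣ + 1 ≡ r) (h₁₂₃ : ∣ E₁ ∩ E₂ ∩ E₃ ∣ + 2 ≡ r) where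

  E₂⊆E₁∪E₃ : E₂ ⊆ E₁ ∪ E₃
  E₂⊆E₁∪E₃ x∈E₂ = x∈p∪q⁺ (Sum.map (p∩q⊆p E₁ E₂) (p∩q⊆q E₂ E₃) (x∈p∪q⁻ A B (E₂⊆A∪B x∈E₂)))
    where
    A B : Subset n
    A = E₁ ∩ E₂
    B = E₂ ∩ E₃

    A∪B⊆E₂ : A ∪ B ⊆ E₂
    A∪B⊆E₂ x∈A∪B = [ p∩q⊆q E₁ E₂ , p∩q⊆p E₂ E₃ ]′ (x∈p∪q⁻ A B x∈A∪B)

    A∩B⊆E₁∩E₂∩E₃ : A ∩ B ⊆ E₁ ∩ E₂ ∩ E₃
    A∩B⊆E₁∩E₂∩E₃ x∈A∩B = x∈p∩q⁺ (p∩q⊆p E₁ E₂ (p∩q⊆p A B x∈A∩B) , p∩q⊆q A B x∈A∩B)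

    ∣A∩B∣<∣B∣ : ∣ A ∩ B ∣ < ∣ B ∣
    ∣A∩B∣<∣B∣ = ≤-<-trans (p⊆q⇒∣p∣≤∣q∣ A∩B⊆E₁∩E₂∩E₃) (m+2≡r∧n+1≡r⇒m<n h₁₂₃ h₂₃)

    ∣E₂∣≤∣A∪B∣ : ∣ E₂ ∣ ≤ ∣ A ∪ B ∣
    ∣E₂∣≤∣A∪B∣ = begin
      ∣ E₂ ∣     ≡⟨ trans ∣E₂∣≡r (sym h₁₂) ⟩
      ∣ A ∣ + 1  ≡⟨ +-comm ∣ A ∣ 1 ⟩
      suc ∣ A ∣  ≤⟨ m+n≡o+p∧n<p⇒o<m (∣p∪q∣+∣p∩q∣≡∣p∣+∣q∣ A B) ∣A∩B∣<∣B∣ ⟩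
      ∣ A ∪ B ∣  ∎
      where open ≤-Reasoning

    E₂⊆A∪B : E₂ ⊆ A ∪ B
    E₂⊆A∪B = p⊆q⇒∣q∣≤∣p∣⇒q⊆p A∪B⊆E₂ ∣E₂∣≤∣A∪B∣

module _ {r n m} {G : RGraph r n} {F : RGraph r m} (W : ShadowHomWitness G F) where

  edgeMap : ∀ {E} → IsEdge G E → ∀ {x} → x ∈ E → Fin m
  edgeMap {E} p {x} x∈E = proj₁ (Bijection.to (gE W E p) (x , x∈E))

  edgeMap-∈ : ∀ {E} (p : IsEdge G E) {x} (x∈E : x ∈ E) → edgeMap p x∈E ∈ fE W E p
  edgeMap-∈ {E} p {x} x∈E = proj₂ (Bijection.to (gE W E p) (x , x∈E))

  edgeMap-irrelevant : ∀ {E} (p : IsEdge G E) {x} (x∈E x∈E′ : x ∈ E) → edgeMap p x∈E ≡ edgeMap p x∈E′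
  edgeMap-irrelevant p x∈E x∈E′ = cong (edgeMap p) ([]=-irrelevant x∈E x∈E′)

  edgeMap-injective : ∀ {E} (p : IsEdge G E) {x y} (x∈E : x ∈ E) (y∈E : y ∈ E) →
                      edgeMap p x∈E ≡ edgeMap p y∈E → x ≡ y
  edgeMap-injective {E} p x∈E y∈E eq =
    cong proj₁ (Bijection.injective (gE W E p) (Elem-≡ eq))

  edgeMap-surjective : ∀ {E} (p : IsEdge G E) {w} → w ∈ fE W E p → ∃ λ y → Σ[ y∈E ∈ y ∈ E ] edgeMap p y∈E ≡ w
  edgeMap-surjective {E} p {w} w∈fE with Bijection.strictlySurjective (gE W E p) (w , w∈fE)
  ... | (y , y∈E) , eq = y , y∈E , cong proj₁ eq

  edgeMap-agree : ∀ {E E′} (p : IsEdge G E) (p′ : IsEdge G E′) → ∣ E ∩ E′ ∣ + 1 ≡ r →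
                  ∀ {x} (x∈E : x ∈ E) (x∈E′ : x ∈ E′) → edgeMap p x∈E ≡ edgeMap p′ x∈E′
  edgeMap-agree {E} {E′} p p′ ∣E∩E′∣+1≡r {x} x∈E x∈E′ = begin
    edgeMap p x∈E                                     ≡⟨ edgeMap-irrelevant p x∈E _ ⟩
    edgeMap p (p∩q⊆p E E′ x∈S)                        ≡⟨ compat W E p S S-shadow (p∩q⊆p E E′) (x , x∈S) ⟨
    proj₁ (Bijection.to (gS W S S-shadow) (x , x∈S))  ≡⟨ compat W E′ p′ S S-shadow (p∩q⊆q E E′) (x , x∈S) ⟩
    edgeMap p′ (p∩q⊆q E E′ x∈S)                       ≡⟨ edgeMap-irrelevant p′ _ x∈E′ ⟩
    edgeMap p′ x∈E′                                   ∎
    where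
    open ≡-Reasoning
    S : Subset n
    S = E ∩ E′
    S-shadow : InShadow G S
    S-shadow = ∣E∩E′∣+1≡r , E , p , p∩q⊆p E E′
    x∈S : x ∈ S
    x∈S = x∈p∩q⁺ (x∈E , x∈E′)

lemma4p2 : {r n m : ℕ} (G : RGraph r n) (F : RGraph r m) (W : ShadowHomWitness G F)
           (E₁ E₂ E₃ : _) (p₁ : IsEdge G E₁) (p₂ : IsEdge G E₂) (p₃ : IsEdge G E₃) →
           ∣ E₁ ∩ E₂ ∣ + 1 ≡ r → ∣ E₁ ∩ E₃ ∣ + 1 ≡ r → ∣ E₂ ∩ E₃ ∣ + 1 ≡ r →
           ∣ E₁ ∩ E₂ ∩ E₃ ∣ + 2 ≡ r →
           fE W E₁ p₁ ≢ fE W E₂ p₂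
lemma4p2 G F W E₁ E₂ E₃ p₁ p₂ p₃ h₁₂ h₁₃ h₂₃ h₁₂₃ f₁≡f₂
  with a , a∈E₁ , a∈E₃ , a∉E₂ ← ∃[E₁∩E₃∖E₂] h₁₃ h₁₂₃
  with y , y∈E₂ , g₂y≡g₁a ← edgeMap-surjective W p₂ (subst (_ ∈_) f₁≡f₂ (edgeMap-∈ W p₁ a∈E₁))
  with x∈p∪q⁻ E₁ E₃ (E₂⊆E₁∪E₃ (uniform G E₂ p₂) h₁₂ h₂₃ h₁₂₃ y∈E₂)
... | inj₁ y∈E₁ = a∉E₂ (subst (_∈ E₂) y≡a y∈E₂)
  where
  y≡a : y ≡ a
  y≡a = edgeMap-injective W p₁ y∈E₁ a∈E₁ (trans (edgeMap-agree W p₁ p₂ h₁₂ y∈E₁ y∈E₂) g₂y≡g₁a)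
... | inj₂ y∈E₃ = a∉E₂ (subst (_∈ E₂) y≡a y∈E₂)
  where
  y≡a : y ≡ a
  y≡a = edgeMap-injective W p₃ y∈E₃ a∈E₃ (begin
    edgeMap W p₃ y∈E₃  ≡⟨ edgeMap-agree W p₂ p₃ h₂₃ y∈E₂ y∈E₃ ⟨
    edgeMap W p₂ y∈E₂  ≡⟨ g₂y≡g₁a ⟩
    edgeMap W p₁ a∈E₁  ≡⟨ edgeMap-agree W p₁ p₃ h₁₃ a∈E₁ a∈E₃ ⟩
    edgeMap W p₃ a∈E₃  ∎)
    where open ≡-Reasoning
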